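{- Let $W$ be a connected simple plane graph having exactly two vertices of degree 1, exactly one vertex of degree 2, and all other vertices of degree 4. Suppose the vertices of degree less than 4 are pairwise non-adjacent and all lie on the outer face. Then $W$ has at least 5 vertices of degree 4. -}

module Defs where

-- Combinatorial model of a (connected) simple plane graph via a rotation system
-- (Heffter–Edmonds): each vertex carries the cyclic (clockwise) order of its
-- neighbours.  Faces are the orbits of the face-tracing permutation on darts;
-- the embedding is planar (genus 0) iff Euler's formula V - E + F = 2 holds.

open import Data.Nat using (ℕ; zero; suc; _+_; _*_; _≤ᵇ_; _<ᵇ_; _<_; _≤_)
open import Data.Nat.Properties using () renaming (_≟_ to _≟ℕ_)
open import Data.Bool using (Bool; true; false; _∧_; T)
open import Data.Fin using (Fin; toℕ; _≟_)
open import Data.List using (List; []; _∷_; length; filter; upTo; allFin; map)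
open import Data.Bool.ListAction using (any; all)
open import Data.Nat.ListAction using (sum)
open import Relation.Nullary using (yes; no)
open import Data.List.Membership.Propositional using (_∈_; _∉_)
open import Data.List.Relation.Unary.Unique.Propositional using (Unique)
open import Data.Product using (_×_; _,_; proj₁; proj₂; Σ; ∃)
open import Relation.Binary.PropositionalEquality using (_≡_)
open import Relation.Nullary.Decidable using (⌊_⌋; T?)

record RotationSystem (n : ℕ) : Set where
  field
    rot      : Fin n → List (Fin n)
    unique   : ∀ v → Unique (rot v)
    loopless : ∀ v → v ∉ rot v
    symm     : ∀ u v → u ∈ rot v → v ∈ rot u

module _ {n : ℕ} (G : RotationSystem n) where
  open RotationSystem G

  Adj : Fin n → Fin n → Set
  Adj u v = u ∈ rot v

  adjᵇ : Fin n → Fin n → Bool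
  adjᵇ u v = any (λ w → ⌊ w ≟ u ⌋) (rot v)

  deg : Fin n → ℕ
  deg v = length (rot v)

  countDeg : ℕ → ℕ
  countDeg k = length (filter (λ v → deg v ≟ℕ k) (allFin n))

  numEdges : ℕ
  numEdges = sum (map (λ u → length (filter (λ v → T? ((toℕ u <ᵇ toℕ v) ∧ adjᵇ u v)) (allFin n))) (allFin n))

  data Reach : Fin n → Fin n → Set where
    here : ∀ {v} → Reach v v
    step : ∀ {u v w} → Adj v u → Reach v w → Reach u w

  Connected : Set
  Connected = ∀ u v → Reach u v

-- successor of x in the cyclic list; nextGo h a l x scans the list a ∷ l
-- (h is the head of the whole list, used to wrap around)
nextGo : ∀ {n} → Fin n → Fin n → List (Fin n) → Fin n → Fin n
nextGo h a [] x = h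
nextGo h a (b ∷ l) x with a ≟ x
... | yes _ = b
... | no _ = nextGo h b l x

next : ∀ {n} → List (Fin n) → Fin n → Fin n
next [] x = x
next (a ∷ l) x = nextGo a a l x

iter : ∀ {A : Set} → ℕ → (A → A) → A → A
iter zero f a = a
iter (suc k) f a = f (iter k f a)

module _ {n : ℕ} (G : RotationSystem n) where
  open RotationSystem G

  -- A dart (u , v) is the edge uv directed from u to v.
  Dart : Set
  Dart = Fin n × Fin n

  IsDart : Dart → Set
  IsDart (u , v) = Adj G v u

  faceStep : Dart → Dart
  faceStep (u , v) = (v , next (rot v) u)

  -- bound on orbit lengths (number of darts ≤ n*n)
  bound : ℕ
  bound = n * n

  code : Dart → ℕ
  code (u , v) = toℕ u * n + toℕ v

  -- d is the code-minimal dart of its face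
  isFaceRep : Dart → Bool
  isFaceRep d = adjᵇ G (proj₂ d) (proj₁ d) ∧ all (λ k → code d ≤ᵇ code (iter k faceStep d)) (upTo bound)

  numFaces : ℕ
  numFaces = sum (map (λ u → length (filter (λ v → T? (isFaceRep (u , v))) (allFin n))) (allFin n))

  Planar : Set
  Planar = n + numFaces ≡ 2 + numEdges G

  OnFace : Dart → Fin n → Set
  OnFace d w = T (any (λ k → ⌊ proj₁ (iter k faceStep d) ≟ w ⌋) (upTo bound))

module Submission where

-- Let k be the number of degree-4 vertices and call the three vertices of degree < 4
-- "low".  Counting gives n = 3 + k and Σ deg = 4 + 4k, so E = 2 + 2k by the handshake
-- lemma and F = 1 + k by Euler's formula.  Suppose k ≤ 4.  Then no degree-4 vertex has
-- two low neighbours (double counting the 4 low/high incidences), so the outer face,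
-- which passes through every low vertex, contains three distinct darts around each of
-- them: 9 darts in all.  Every edge has an endpoint of degree 4, so there are no faces
-- of length ≤ 2, and the remaining F - 1 faces have at least three darts each.  Hence
-- 9 + 3(F - 1) ≤ 2E, i.e. 9 + 3k ≤ 4 + 4k, so k ≥ 5, a contradiction.

open import Defs
open import Data.Bool using (Bool; true; false; _∧_; T)
open import Data.Bool.Properties using (T-∧; T-≡)
open import Data.Empty using (⊥; ⊥-elim)
open import Data.Fin using (Fin; toℕ; _≟_; combine)
import Data.Fin.Properties as Fin
open import Data.List using (List; []; _∷_; length; filter; _++_; map; concatMap; upTo; allFin)
open import Data.List.Properties using (length-map; length-++; length-filter; map-cong; filter-≐; filter-accept; filter-reject; length-tabulate)
open import Data.List.Membership.Propositional using (_∈_; _∉_; find; lose)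
open import Data.List.Membership.Propositional.Properties
  using (∈-map⁺; ∈-map⁻; ∈-filter⁺; ∈-filter⁻; ∈-++⁻; ∈-concatMap⁺; ∈-concatMap⁻; ∈-allFin; ∈-upTo⁺)
open import Data.List.Relation.Unary.All using (All; []; _∷_)
import Data.List.Relation.Unary.All as All
open import Data.List.Relation.Unary.All.Properties using (all⁺)
open import Data.List.Relation.Unary.Any using (here; there)
open import Data.List.Relation.Unary.Any.Properties using (any⁺; any⁻)
open import Data.List.Relation.Unary.AllPairs using ([]; _∷_)
open import Data.List.Relation.Unary.Unique.Propositional using (Unique)
open import Data.List.Relation.Unary.Unique.Propositional.Properties using (++⁺; map⁺; filter⁺; allFin⁺)
open import Data.Nat using (ℕ; zero; suc; _+_; _*_; _∸_; _<_; _≤_; _<?_; _<ᵇ_; z≤n; s≤s; s≤s⁻¹)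
open import Data.Nat.Properties hiding (_≟_)
open import Data.Nat.Properties using () renaming (_≟_ to _≟ℕ_)
open import Data.Nat.DivMod using (_%_; _/_; m≡m%n+[m/n]*n; m%n<n)
open import Data.Nat.ListAction using (sum)
open import Data.Nat.Tactic.RingSolver using (solve-∀)
open import Data.Product using (Σ; ∃; _×_; _,_; proj₁; proj₂)
open import Data.Product.Properties using (≡-dec)
open import Data.Sum using (_⊎_; inj₁; inj₂)
open import Function using (_∘_; Equivalence)
open import Relation.Binary using (DecidableEquality; tri<; tri≈; tri>)
open import Relation.Binary.PropositionalEquality
open import Relation.Nullary using (¬_; yes; no; ¬?)
open import Relation.Nullary.Decidable using (⌊_⌋; T?; toWitness; fromWitness)
open import Relation.Nullary.Negation using (contradiction)
open import Relation.Unary using (Pred; Decidable)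
open import Relation.Unary.Properties using (∁?)
open import Level using (0ℓ)
open import Algebra.Properties.CommutativeSemigroup +-commutativeSemigroup using (x∙yz≈y∙xz; interchange)

module _ {A : Set} where

  unique-length-≤ : (_≟ᴬ_ : DecidableEquality A) {xs ys : List A} →
    Unique xs → (∀ {x} → x ∈ xs → x ∈ ys) → length xs ≤ length ys
  unique-length-≤ _≟ᴬ_ {[]} _ _ = z≤n
  unique-length-≤ _≟ᴬ_ {x ∷ xs} {ys} (x∉xs ∷ xs!) xs⊆ys =
    ≤-trans (s≤s (unique-length-≤ _≟ᴬ_ xs! xs⊆ys-x)) (remove-shortens ys (xs⊆ys (here refl)))
    where
    ys-x : List A
    ys-x = filter (λ y → ¬? (y ≟ᴬ x)) ys

    remove-shortens : ∀ zs → x ∈ zs → suc (length (filter (λ y → ¬? (y ≟ᴬ x)) zs)) ≤ length zs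
    remove-shortens (z ∷ zs) x∈ with z ≟ᴬ x | x∈
    ... | yes _ | _ = s≤s (length-filter _ zs)
    ... | no z≢x | here x≡z = contradiction (sym x≡z) z≢x
    ... | no _ | there x∈zs = s≤s (remove-shortens zs x∈zs)

    xs⊆ys-x : ∀ {y} → y ∈ xs → y ∈ ys-x
    xs⊆ys-x y∈xs = ∈-filter⁺ _ (xs⊆ys (there y∈xs)) (λ y≡x → All.lookup x∉xs y∈xs (sym y≡x))

  unique-length-≤1 : {xs : List A} → Unique xs → (∀ {x y} → x ∈ xs → y ∈ xs → x ≡ y) → length xs ≤ 1
  unique-length-≤1 {[]} _ _ = z≤n
  unique-length-≤1 {_ ∷ []} _ _ = ≤-refl
  unique-length-≤1 {_ ∷ _ ∷ _} ((x≢y ∷ _) ∷ _) all-equal = contradiction (all-equal (here refl) (there (here refl))) x≢y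

  length-filter-∁ : {P : Pred A 0ℓ} (P? : Decidable P) (xs : List A) →
    length (filter P? xs) + length (filter (∁? P?) xs) ≡ length xs
  length-filter-∁ P? [] = refl
  length-filter-∁ P? (x ∷ xs) with P? x
  ... | yes _ = cong suc (length-filter-∁ P? xs)
  ... | no _ = trans (+-suc _ _) (cong suc (length-filter-∁ P? xs))

  sum-filter-∁ : {P : Pred A 0ℓ} (P? : Decidable P) (f : A → ℕ) (xs : List A) →
    sum (map f (filter P? xs)) + sum (map f (filter (∁? P?) xs)) ≡ sum (map f xs)
  sum-filter-∁ P? f [] = refl
  sum-filter-∁ P? f (x ∷ xs) with P? x
  ... | yes _ = trans (+-assoc (f x) _ _) (cong (f x +_) (sum-filter-∁ P? f xs))
  ... | no _ = trans (x∙yz≈y∙xz (sum (map f (filter P? xs))) (f x) _) (cong (f x +_) (sum-filter-∁ P? f xs))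

  sum-const : (f : A → ℕ) (c : ℕ) (xs : List A) → (∀ {x} → x ∈ xs → f x ≡ c) →
    sum (map f xs) ≡ c * length xs
  sum-const f c [] _ = sym (*-zeroʳ c)
  sum-const f c (x ∷ xs) f≡c =
    trans (cong₂ _+_ (f≡c (here refl)) (sum-const f c xs (f≡c ∘ there))) (sym (*-suc c (length xs)))

  sum-≥ : (f : A → ℕ) (m : ℕ) (xs : List A) {x₀ : A} → (∀ {x} → x ∈ xs → m ≤ f x) → x₀ ∈ xs →
    (length xs ∸ 1) * m + f x₀ ≤ sum (map f xs)
  sum-≥ f m (x ∷ xs) m≤f (here refl) =
    ≤-trans (≤-reflexive (+-comm _ (f x))) (+-monoʳ-≤ (f x) (all-≥ xs (m≤f ∘ there)))
    where
    all-≥ : ∀ ys → (∀ {y} → y ∈ ys → m ≤ f y) → length ys * m ≤ sum (map f ys)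
    all-≥ [] _ = z≤n
    all-≥ (y ∷ ys) m≤f' = +-mono-≤ (m≤f' (here refl)) (all-≥ ys (m≤f' ∘ there))
  sum-≥ f m (x ∷ y ∷ xs) {x₀} m≤f (there x₀∈) =
    ≤-trans (≤-reflexive (+-assoc m _ (f x₀))) (+-mono-≤ (m≤f (here refl)) (sum-≥ f m (y ∷ xs) (m≤f ∘ there) x₀∈))

module _ {A B : Set} (f : A → List B) where

  ∈-concatMap-∃ : ∀ {y xs} → y ∈ concatMap f xs → ∃ λ x → x ∈ xs × y ∈ f x
  ∈-concatMap-∃ = find ∘ ∈-concatMap⁻ f

  length-concatMap : ∀ xs → length (concatMap f xs) ≡ sum (map (length ∘ f) xs)
  length-concatMap [] = refl
  length-concatMap (x ∷ xs) = trans (length-++ (f x)) (cong (length (f x) +_) (length-concatMap xs))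

  concatMap-unique : ∀ xs → Unique xs → (∀ {x} → x ∈ xs → Unique (f x)) →
    (∀ {x x' y} → x ∈ xs → x' ∈ xs → y ∈ f x → y ∈ f x' → x ≡ x') → Unique (concatMap f xs)
  concatMap-unique [] _ _ _ = []
  concatMap-unique (x ∷ xs) (x∉xs ∷ xs!) blocks! disjoint =
    ++⁺ (blocks! (here refl)) (concatMap-unique xs xs! (blocks! ∘ there) (λ p q → disjoint (there p) (there q)))
      λ (y∈fx , y∈rest) → let x' , x'∈xs , y∈fx' = ∈-concatMap-∃ y∈rest in
        All.lookup x∉xs x'∈xs (disjoint (here refl) (there x'∈xs) y∈fx y∈fx')

module _ {n : ℕ} where

  nextGo-∈ : ∀ (h a : Fin n) l x → x ∈ a ∷ l → nextGo h a l x ∈ l ⊎ nextGo h a l x ≡ h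
  nextGo-∈ h a [] x _ = inj₂ refl
  nextGo-∈ h a (b ∷ l) x x∈ with a ≟ x | x∈
  ... | yes _ | _ = inj₁ (here refl)
  ... | no a≢x | here x≡a = contradiction (sym x≡a) a≢x
  ... | no _ | there x∈bl with nextGo-∈ h b l x x∈bl
  ...   | inj₁ ∈l = inj₁ (there ∈l)
  ...   | inj₂ ≡h = inj₂ ≡h

  next-∈ : ∀ (l : List (Fin n)) x → x ∈ l → next l x ∈ l
  next-∈ (a ∷ l) x x∈ with nextGo-∈ a a l x x∈
  ... | inj₁ ∈l = there ∈l
  ... | inj₂ ≡a = here ≡a

  nextGo-≢-head : ∀ (h b : Fin n) l y → h ∉ b ∷ l → Unique (b ∷ l) → y ∈ b ∷ l → nextGo h b l y ≢ b
  nextGo-≢-head h b l y h∉ (b∉l ∷ _) y∈ eq with nextGo-∈ h b l y y∈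
  ... | inj₁ ∈l = All.lookup b∉l (subst (_∈ l) eq ∈l) refl
  ... | inj₂ ≡h = h∉ (here (trans (sym ≡h) eq))

  nextGo-injective : ∀ (h a : Fin n) l x y → h ∉ l → Unique (a ∷ l) → x ∈ a ∷ l → y ∈ a ∷ l →
    nextGo h a l x ≡ nextGo h a l y → x ≡ y
  nextGo-injective h a [] x y _ _ (here x≡a) (here y≡a) _ = trans x≡a (sym y≡a)
  nextGo-injective h a (b ∷ l) x y h∉ (_ ∷ bl!) x∈ y∈ eq with a ≟ x | a ≟ y | x∈ | y∈
  ... | yes a≡x | yes a≡y | _ | _ = trans (sym a≡x) a≡y
  ... | no a≢x | _ | here x≡a | _ = contradiction (sym x≡a) a≢x
  ... | _ | no a≢y | _ | here y≡a = contradiction (sym y≡a) a≢y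
  ... | yes _ | no _ | _ | there y∈bl = contradiction (sym eq) (nextGo-≢-head h b l y h∉ bl! y∈bl)
  ... | no _ | yes _ | there x∈bl | _ = contradiction eq (nextGo-≢-head h b l x h∉ bl! x∈bl)
  ... | no _ | no _ | there x∈bl | there y∈bl = nextGo-injective h b l x y (h∉ ∘ there) bl! x∈bl y∈bl eq

  next-injective : ∀ (l : List (Fin n)) {x y} → Unique l → x ∈ l → y ∈ l → next l x ≡ next l y → x ≡ y
  next-injective (a ∷ l) {x} {y} l!@(a∉l ∷ _) = nextGo-injective a a l x y (λ a∈l → All.lookup a∉l a∈l refl) l!

  nextGo-moves : ∀ (h a : Fin n) l x → h ∉ a ∷ l → Unique (a ∷ l) → x ∈ a ∷ l → nextGo h a l x ≢ x
  nextGo-moves h a [] x h∉ _ (here x≡a) eq = h∉ (here (trans eq x≡a))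
  nextGo-moves h a (b ∷ l) x h∉ (a∉bl ∷ bl!) x∈ eq with a ≟ x | x∈
  ... | yes a≡x | _ = All.lookup a∉bl (here refl) (trans a≡x (sym eq))
  ... | no a≢x | here x≡a = a≢x (sym x≡a)
  ... | no _ | there x∈bl = nextGo-moves h b l x (h∉ ∘ there) bl! x∈bl eq

  next-moves : ∀ (l : List (Fin n)) {x} → Unique l → 2 ≤ length l → x ∈ l → next l x ≢ x
  next-moves (a ∷ b ∷ l) {x} (a∉bl ∷ bl!) _ x∈ eq with a ≟ x | x∈
  ... | yes a≡x | _ = All.lookup a∉bl (here refl) (trans a≡x (sym eq))
  ... | no a≢x | here x≡a = a≢x (sym x≡a)
  ... | no _ | there x∈bl = nextGo-moves a b l x (λ a∈bl → All.lookup a∉bl a∈bl refl) bl! x∈bl eq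
  next-moves (a ∷ []) _ (s≤s ()) _

ind : Bool → ℕ
ind true = 1
ind false = 0

bool-ext : ∀ {a b} → (T a → T b) → (T b → T a) → a ≡ b
bool-ext {false} {false} _ _ = refl
bool-ext {false} {true} _ b⇒a = ⊥-elim (b⇒a _)
bool-ext {true} {false} a⇒b _ = ⊥-elim (a⇒b _)
bool-ext {true} {true} _ _ = refl

<ᵇ-true : ∀ {m n} → m < n → (m <ᵇ n) ≡ true
<ᵇ-true m<n = Equivalence.to T-≡ (<⇒<ᵇ m<n)

<ᵇ-false : ∀ {m n} → ¬ m < n → (m <ᵇ n) ≡ false
<ᵇ-false {m} {n} m≮n = bool-ext (m≮n ∘ <ᵇ⇒< m n) λ ()

module _ {A : Set} where

  sum-cong : ∀ (xs : List A) {f g : A → ℕ} → (∀ x → f x ≡ g x) → sum (map f xs) ≡ sum (map g xs)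
  sum-cong xs f≗g = cong sum (map-cong f≗g xs)

  count-as-sum : ∀ (p : A → Bool) xs → length (filter (λ x → T? (p x)) xs) ≡ sum (map (ind ∘ p) xs)
  count-as-sum p [] = refl
  count-as-sum p (x ∷ xs) with p x
  ... | true = cong suc (count-as-sum p xs)
  ... | false = count-as-sum p xs

  sum-+ : ∀ (f g : A → ℕ) xs → sum (map (λ x → f x + g x) xs) ≡ sum (map f xs) + sum (map g xs)
  sum-+ f g [] = refl
  sum-+ f g (x ∷ xs) = trans (cong (f x + g x +_) (sum-+ f g xs)) (interchange (f x) (g x) _ _)

module _ {A B : Set} where

  sum-swap : ∀ (g : A → B → ℕ) xs ys →
    sum (map (λ x → sum (map (g x) ys)) xs) ≡ sum (map (λ y → sum (map (λ x → g x y) xs)) ys)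
  sum-swap g [] ys = sym (sum-const _ 0 ys (λ _ → refl))
  sum-swap g (x ∷ xs) ys = trans (cong (sum (map (g x) ys) +_) (sum-swap g xs ys))
    (sym (sum-+ (g x) (λ y → sum (map (λ x → g x y) xs)) ys))

module _ {A : Set} (f : A → A) where

  iter-+ : ∀ m k x → iter (m + k) f x ≡ iter m f (iter k f x)
  iter-+ zero k x = refl
  iter-+ (suc m) k x = cong f (iter-+ m k x)

  iter-multiple : ∀ q x → iter q f x ≡ x → ∀ r → iter (r * q) f x ≡ x
  iter-multiple q x cycle zero = refl
  iter-multiple q x cycle (suc r) =
    trans (iter-+ q (r * q) x) (trans (cong (iter q f) (iter-multiple q x cycle r)) cycle)

  iter-mod : ∀ q x → iter (suc q) f x ≡ x → ∀ m → iter m f x ≡ iter (m % suc q) f x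
  iter-mod q x cycle m = begin
    iter m f x                                                  ≡⟨ cong (λ t → iter t f x) (m≡m%n+[m/n]*n m (suc q)) ⟩
    iter (m % suc q + m / suc q * suc q) f x                    ≡⟨ iter-+ (m % suc q) _ x ⟩
    iter (m % suc q) f (iter (m / suc q * suc q) f x)           ≡⟨ cong (iter (m % suc q) f) (iter-multiple (suc q) x cycle (m / suc q)) ⟩
    iter (m % suc q) f x                                        ∎
    where open ≡-Reasoning

-- Darts and faces of a rotation system.

module RotationFacts {n : ℕ} (W : RotationSystem n) where
  open RotationSystem W

  adjᵇ⇒Adj : ∀ {u v} → T (adjᵇ W u v) → Adj W u v
  adjᵇ⇒Adj {u} {v} t = let w , w∈ , w≟u = find (any⁻ _ (rot v) t) in subst (_∈ rot v) (toWitness w≟u) w∈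

  Adj⇒adjᵇ : ∀ {u v} → Adj W u v → T (adjᵇ W u v)
  Adj⇒adjᵇ u∈ = any⁺ _ (Data.List.Relation.Unary.Any.map (λ u≡w → fromWitness (sym u≡w)) u∈)

  φ : Dart W → Dart W
  φ = faceStep W

  _≟ᵈ_ : DecidableEquality (Dart W)
  _≟ᵈ_ = ≡-dec _≟_ _≟_

  open import Data.List.Membership.DecPropositional _≟ᵈ_ using (_∈?_)

  φ-isDart : ∀ {d} → IsDart W d → IsDart W (φ d)
  φ-isDart {u , v} v∈u = next-∈ (rot v) u (symm v u v∈u)

  iter-isDart : ∀ {d} k → IsDart W d → IsDart W (iter k φ d)
  iter-isDart zero d-dart = d-dart
  iter-isDart (suc k) d-dart = φ-isDart (iter-isDart k d-dart)

  -- φ is injective on darts, because each rotation is duplicate-free.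
  φ-injective : ∀ {d e} → IsDart W d → IsDart W e → φ d ≡ φ e → d ≡ e
  φ-injective {u , v} {u' , v'} d-dart e-dart eq with refl ← cong proj₁ eq =
    cong (_, v) (next-injective (rot v) (unique v) (symm v u d-dart) (symm v u' e-dart) (cong proj₂ eq))

  iter-injective : ∀ {d e} k → IsDart W d → IsDart W e → iter k φ d ≡ iter k φ e → d ≡ e
  iter-injective zero _ _ eq = eq
  iter-injective (suc k) d-dart e-dart eq =
    iter-injective k d-dart e-dart (φ-injective (iter-isDart k d-dart) (iter-isDart k e-dart) eq)

  -- φ has no fixed dart, since there are no loops.
  φ-moves : ∀ {d} → IsDart W d → φ d ≢ d
  φ-moves {u , v} v∈u eq = loopless u (subst (_∈ rot u) (cong proj₁ eq) v∈u)

  -- Darts are encoded in Fin (n * n); `code` is the numeric value of this encoding.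
  encode : Dart W → Fin (n * n)
  encode (u , v) = combine u v

  encode-injective : ∀ {d e} → encode d ≡ encode e → d ≡ e
  encode-injective {u , v} {u' , v'} eq with refl , refl ← Fin.combine-injective u v u' v' eq = refl

  code-injective : ∀ {d e} → code W d ≡ code W e → d ≡ e
  code-injective {d} {e} eq = encode-injective (Fin.toℕ-injective (trans (sym (code≡ d)) (trans eq (code≡ e))))
    where
    code≡ : ∀ d → code W d ≡ toℕ (encode d)
    code≡ (u , v) = trans (cong (_+ toℕ v) (*-comm (toℕ u) n)) (sym (Fin.toℕ-combine u v))

  -- Every dart lies on a cycle of φ of length at most bound W (pigeonhole + injectivity).
  period : ∀ {d} → IsDart W d → ∃ λ p → suc p ≤ bound W × iter (suc p) φ d ≡ d
  period {d} d-dart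
    with i , j , i<j , same ← Fin.pigeonhole (n<1+n (n * n)) (λ k → encode (iter (toℕ k) φ d))
    = p , p<bound , sym (iter-injective (toℕ i) d-dart (iter-isDart (suc p) d-dart) iᵗʰ≡)
    where
    p : ℕ
    p = toℕ j ∸ suc (toℕ i)
    j∸i≡ : toℕ j ∸ toℕ i ≡ suc p
    j∸i≡ = +-∸-assoc 1 i<j
    p<bound : suc p ≤ n * n
    p<bound = subst (_≤ n * n) j∸i≡ (≤-trans (m∸n≤m (toℕ j) (toℕ i)) (s≤s⁻¹ (Fin.toℕ<n j)))
    iᵗʰ≡ : iter (toℕ i) φ d ≡ iter (toℕ i) φ (iter (suc p) φ d)
    iᵗʰ≡ = begin
      iter (toℕ i) φ d                    ≡⟨ encode-injective same ⟩
      iter (toℕ j) φ d                    ≡⟨ cong (λ t → iter t φ d) (sym (m+[n∸m]≡n (<⇒≤ i<j))) ⟩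
      iter (toℕ i + (toℕ j ∸ toℕ i)) φ d  ≡⟨ cong (λ t → iter (toℕ i + t) φ d) j∸i≡ ⟩
      iter (toℕ i + suc p) φ d            ≡⟨ iter-+ φ (toℕ i) (suc p) d ⟩
      iter (toℕ i) φ (iter (suc p) φ d)   ∎
      where open ≡-Reasoning

  _↝_ : Dart W → Dart W → Set
  d ↝ e = ∃ λ m → iter m φ d ≡ e

  ↝-trans : ∀ {d e f} → d ↝ e → e ↝ f → d ↝ f
  ↝-trans {d} (m , refl) (k , refl) = k + m , iter-+ φ k m d

  ↝-sym : ∀ {d e} → IsDart W d → d ↝ e → e ↝ d
  ↝-sym {d} d-dart (m , refl) with p , _ , cycle ← period d-dart =
    m * p , (begin
      iter (m * p) φ (iter m φ d)  ≡⟨ sym (iter-+ φ (m * p) m d) ⟩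
      iter (m * p + m) φ d         ≡⟨ cong (λ t → iter t φ d) (trans (+-comm (m * p) m) (sym (*-suc m p))) ⟩
      iter (m * suc p) φ d         ≡⟨ iter-multiple φ (suc p) d cycle m ⟩
      d                            ∎)
    where open ≡-Reasoning

  ↝-isDart : ∀ {d e} → IsDart W d → d ↝ e → IsDart W e
  ↝-isDart d-dart (k , refl) = iter-isDart k d-dart

  ↝-bounded : ∀ {d e} → IsDart W d → d ↝ e → ∃ λ m → m < bound W × iter m φ d ≡ e
  ↝-bounded {d} d-dart (m , refl) with p , p<bound , cycle ← period d-dart =
    m % suc p , ≤-trans (m%n<n m (suc p)) p<bound , sym (iter-mod φ p d cycle m)

  orbit : Dart W → List (Dart W)
  orbit d = map (λ k → iter k φ d) (upTo (bound W))

  ↝? : ∀ {d} → IsDart W d → Decidable (d ↝_)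
  ↝? {d} d-dart e with e ∈? orbit d
  ... | yes e∈ = yes (let k , _ , e≡ = ∈-map⁻ _ e∈ in k , sym e≡)
  ... | no e∉ = no λ d↝e → let m , m< , e≡ = ↝-bounded d-dart d↝e in
                  e∉ (subst (_∈ orbit d) e≡ (∈-map⁺ _ (∈-upTo⁺ m<)))

  onFace⇒↝ : ∀ {d v} → OnFace W d v → ∃ λ e → d ↝ e × proj₁ e ≡ v
  onFace⇒↝ {d} t = let k , _ , tail≟v = find (any⁻ _ (upTo (bound W)) t) in
    iter k φ d , (k , refl) , toWitness tail≟v

  Rep : Dart W → Set
  Rep d = T (isFaceRep W d)

  rep-isDart : ∀ {d} → Rep d → IsDart W d
  rep-isDart r = adjᵇ⇒Adj (proj₁ (Equivalence.to T-∧ r))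

  rep-minimal : ∀ {d} → Rep d → ∀ {k} → k < bound W → code W d ≤ code W (iter k φ d)
  rep-minimal {d} r k< =
    ≤ᵇ⇒≤ _ _ (All.lookup (all⁺ _ (upTo (bound W)) (proj₂ (Equivalence.to T-∧ r))) (∈-upTo⁺ k<))

  rep-unique : ∀ {d e} → Rep d → Rep e → d ↝ e → d ≡ e
  rep-unique {d} {e} rd re d↝e
    with m , m< , d→e ← ↝-bounded (rep-isDart rd) d↝e
       | k , k< , e→d ← ↝-bounded (rep-isDart re) (↝-sym (rep-isDart rd) d↝e)
    = code-injective (≤-antisym (subst (λ t → code W d ≤ code W t) d→e (rep-minimal rd m<))
                                (subst (λ t → code W e ≤ code W t) e→d (rep-minimal re k<)))

  allDarts : List (Dart W)
  allDarts = concatMap (λ u → map (u ,_) (rot u)) (allFin n)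

  length-allDarts : length allDarts ≡ sum (map (deg W) (allFin n))
  length-allDarts = trans (length-concatMap _ (allFin n)) (sum-cong (allFin n) (λ u → length-map (u ,_) (rot u)))

  ∈-allDarts : ∀ {d} → IsDart W d → d ∈ allDarts
  ∈-allDarts {u , v} v∈u = ∈-concatMap⁺ _ (lose (∈-allFin u) (∈-map⁺ (u ,_) v∈u))

  repHeads : Fin n → List (Fin n)
  repHeads u = filter (λ v → T? (isFaceRep W (u , v))) (allFin n)

  faceReps : List (Dart W)
  faceReps = concatMap (λ u → map (u ,_) (repHeads u)) (allFin n)

  length-faceReps : length faceReps ≡ numFaces W
  length-faceReps = trans (length-concatMap _ (allFin n)) (sum-cong (allFin n) (λ u → length-map (u ,_) (repHeads u)))

  ∈-faceReps : ∀ {d} → d ∈ faceReps → Rep d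
  ∈-faceReps d∈ with u , _ , d∈row ← ∈-concatMap-∃ (λ u → map (u ,_) (repHeads u)) {xs = allFin n} d∈
    with v , v∈ , refl ← ∈-map⁻ (u ,_) d∈row =
    proj₂ (∈-filter⁻ (λ v → T? (isFaceRep W (u , v))) {xs = allFin n} v∈)

  faceReps-unique : Unique faceReps
  faceReps-unique = concatMap-unique _ (allFin n) (allFin⁺ n)
    (λ {u} _ → map⁺ (cong proj₂) (filter⁺ (λ v → T? (isFaceRep W (u , v))) (allFin⁺ n)))
    λ _ _ d∈u d∈u' → trans (sym (tail≡ d∈u)) (tail≡ d∈u')
    where
    tail≡ : ∀ {u d vs} → d ∈ map (u ,_) vs → proj₁ d ≡ u
    tail≡ d∈ with _ , _ , refl ← ∈-map⁻ _ d∈ = refl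

  -- A digon is a face of length 2.  Faces of length 1 do not exist (φ-moves).
  NoDigons : Set
  NoDigons = ∀ d → IsDart W d → iter 2 φ d ≢ d

  -- A face of length 2 consists of darts uv, vu with next (rot v) u ≡ u and
  -- next (rot u) v ≡ v, impossible if u or v has degree at least 2.
  noDigons : (∀ u v → Adj W u v → 2 ≤ deg W u ⊎ 2 ≤ deg W v) → NoDigons
  noDigons big-end (u , v) v∈u digon with big-end u v (symm v u v∈u)
  ... | inj₁ 2≤deg-u = next-moves (rot u) (unique u) 2≤deg-u v∈u
                         (subst (λ t → next (rot t) v ≡ v) (cong proj₁ digon) (cong proj₂ digon))
  ... | inj₂ 2≤deg-v = next-moves (rot v) (unique v) 2≤deg-v (symm v u v∈u) (cong proj₁ digon)

  firstThree : Dart W → List (Dart W)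
  firstThree d = d ∷ φ d ∷ φ (φ d) ∷ []

  firstThree-↝ : ∀ {d x} → x ∈ firstThree d → d ↝ x
  firstThree-↝ (here refl) = 0 , refl
  firstThree-↝ (there (here refl)) = 1 , refl
  firstThree-↝ (there (there (here refl))) = 2 , refl

  firstThree-unique : NoDigons → ∀ {d} → IsDart W d → Unique (firstThree d)
  firstThree-unique noDigon d-dart =
    ((φ-moves d-dart ∘ sym) ∷ (noDigon _ d-dart ∘ sym) ∷ []) ∷ ((φ-moves (φ-isDart d-dart) ∘ sym) ∷ []) ∷ [] ∷ []

  -- If there are no digons, every face other than that of o has at
  -- least three darts, all distinct from a given list S of distinct darts on the face
  -- of o; together they are at most all Σ deg darts:  |S| + 3 (F - 1) ≤ Σ deg.
  face-count : NoDigons → ∀ {o} → IsDart W o → (S : List (Dart W)) → Unique S → (∀ {x} → x ∈ S → o ↝ x) →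
    length S + 3 * numFaces W ≤ 3 + sum (map (deg W) (allFin n))
  face-count noDigon {o} o-dart S S! S-on-o = begin
    length S + 3 * numFaces W              ≤⟨ +-monoʳ-≤ (length S) (*-monoʳ-≤ 3 faces≤) ⟩
    length S + 3 * (1 + length innerReps)  ≡⟨ cong (length S +_) (*-distribˡ-+ 3 1 (length innerReps)) ⟩
    length S + (3 + 3 * length innerReps)  ≡⟨ x∙yz≈y∙xz (length S) 3 _ ⟩
    3 + (length S + 3 * length innerReps)  ≤⟨ +-monoʳ-≤ 3 darts≤ ⟩
    3 + sum (map (deg W) (allFin n))       ∎
    where
    open ≤-Reasoning

    onO? : Decidable (o ↝_)
    onO? = ↝? o-dart

    innerReps : List (Dart W)
    innerReps = filter (∁? onO?) faceReps

    innerRep : ∀ {r} → r ∈ innerReps → Rep r × ¬ (o ↝ r)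
    innerRep r∈ = let r∈reps , r-inner = ∈-filter⁻ (∁? onO?) {xs = faceReps} r∈ in ∈-faceReps r∈reps , r-inner

    outer≤1 : length (filter onO? faceReps) ≤ 1
    outer≤1 = unique-length-≤1 (filter⁺ onO? faceReps-unique) λ r∈ r'∈ →
      let r∈reps , o↝r = ∈-filter⁻ onO? {xs = faceReps} r∈
          r'∈reps , o↝r' = ∈-filter⁻ onO? {xs = faceReps} r'∈
      in rep-unique (∈-faceReps r∈reps) (∈-faceReps r'∈reps) (↝-trans (↝-sym o-dart o↝r) o↝r')

    faces≤ : numFaces W ≤ 1 + length innerReps
    faces≤ = subst (_≤ 1 + length innerReps) (trans (length-filter-∁ onO? faceReps) length-faceReps)
                   (+-monoˡ-≤ (length innerReps) outer≤1)

    innerDarts : List (Dart W)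
    innerDarts = concatMap firstThree innerReps

    length-innerDarts : length innerDarts ≡ 3 * length innerReps
    length-innerDarts = trans (length-concatMap firstThree innerReps) (sum-const _ 3 innerReps (λ _ → refl))

    innerDarts-unique : Unique innerDarts
    innerDarts-unique = concatMap-unique firstThree innerReps (filter⁺ (∁? onO?) faceReps-unique)
      (λ r∈ → firstThree-unique noDigon (rep-isDart (proj₁ (innerRep r∈))))
      λ r∈ r'∈ x∈ x∈' → let r-rep , _ = innerRep r∈ ; r'-rep , _ = innerRep r'∈ in
        rep-unique r-rep r'-rep (↝-trans (firstThree-↝ x∈) (↝-sym (rep-isDart r'-rep) (firstThree-↝ x∈')))

    all-isDart : ∀ {x} → x ∈ S ++ innerDarts → IsDart W x
    all-isDart x∈ with ∈-++⁻ S x∈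
    ... | inj₁ x∈S = ↝-isDart o-dart (S-on-o x∈S)
    ... | inj₂ x∈inner with r , r∈ , x∈r ← ∈-concatMap-∃ firstThree {xs = innerReps} x∈inner =
      ↝-isDart (rep-isDart (proj₁ (innerRep r∈))) (firstThree-↝ x∈r)

    S-inner-disjoint : ∀ {x} → x ∈ S → x ∈ innerDarts → ⊥
    S-inner-disjoint x∈S x∈inner with r , r∈ , x∈r ← ∈-concatMap-∃ firstThree {xs = innerReps} x∈inner =
      let r-rep , r-inner = innerRep r∈ in
      r-inner (↝-trans (S-on-o x∈S) (↝-sym (rep-isDart r-rep) (firstThree-↝ x∈r)))

    darts≤ : length S + 3 * length innerReps ≤ sum (map (deg W) (allFin n))
    darts≤ = subst₂ _≤_ (trans (length-++ S) (cong (length S +_) length-innerDarts)) length-allDarts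
      (unique-length-≤ _≟ᵈ_ (++⁺ S! innerDarts-unique (λ (x∈S , x∈inner) → S-inner-disjoint x∈S x∈inner))
        (∈-allDarts ∘ all-isDart))

  φ-predecessor : ∀ {d} → IsDart W d → ∃ λ e → IsDart W e × φ e ≡ d × d ↝ e
  φ-predecessor {d} d-dart with p , _ , cycle ← period d-dart = iter p φ d , iter-isDart p d-dart , cycle , p , refl

  -- A passage of the face of o through the vertex v: the face enters v along z → v
  -- and leaves along v → w, then continues along w → next (rot w) v.
  record Passage (o : Dart W) (v : Fin n) : Set where
    field
      z w : Fin n
      z-adj : z ∈ rot v
      w-adj : w ∈ rot v
      enters : o ↝ (z , v)
      leaves : o ↝ (v , w)

    darts : List (Dart W)
    darts = (z , v) ∷ (v , w) ∷ φ (v , w) ∷ []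

    darts-on-face : ∀ {x} → x ∈ darts → o ↝ x
    darts-on-face (here refl) = enters
    darts-on-face (there (here refl)) = leaves
    darts-on-face (there (there (here refl))) = ↝-trans leaves (1 , refl)

    darts-tail : ∀ {x} → x ∈ darts → proj₁ x ≡ v ⊎ proj₁ x ∈ rot v
    darts-tail (here refl) = inj₂ z-adj
    darts-tail (there (here refl)) = inj₁ refl
    darts-tail (there (there (here refl))) = inj₂ w-adj

    darts-unique : 2 ≤ deg W w → Unique darts
    darts-unique 2≤deg-w =
      ((λ eq → loopless v (subst (_∈ rot v) (cong proj₁ eq) z-adj))
        ∷ (λ eq → next-moves (rot w) (unique w) 2≤deg-w (symm w v w-adj) (sym (cong proj₂ eq)))
        ∷ [])
      ∷ ((λ eq → loopless v (subst (_∈ rot v) (sym (cong proj₁ eq)) w-adj)) ∷ [])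
      ∷ [] ∷ []

  -- Every vertex on the face of o has a passage: the face leaves v along some dart
  -- v → w, and the predecessor of that dart enters v.
  passage : ∀ {o v} → IsDart W o → OnFace W o v → Passage o v
  passage o-dart v-on-o with (v , w) , o↝vw , refl ← onFace⇒↝ v-on-o
    with (z , .v) , zv-dart , refl , vw↝zv ← φ-predecessor (↝-isDart o-dart o↝vw) =
    record { z = z ; w = w ; z-adj = symm v z zv-dart ; w-adj = ↝-isDart o-dart o↝vw
           ; enters = ↝-trans o↝vw vw↝zv ; leaves = o↝vw }

  adjᵇ-sym : ∀ u v → adjᵇ W u v ≡ adjᵇ W v u
  adjᵇ-sym u v = bool-ext (Adj⇒adjᵇ ∘ symm u v ∘ adjᵇ⇒Adj) (Adj⇒adjᵇ ∘ symm v u ∘ adjᵇ⇒Adj)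

  adjᵇ-irrefl : ∀ u → adjᵇ W u u ≡ false
  adjᵇ-irrefl u = bool-ext (loopless u ∘ adjᵇ⇒Adj) λ ()

  deg-as-count : ∀ u → deg W u ≡ length (filter (λ v → T? (adjᵇ W v u)) (allFin n))
  deg-as-count u = ≤-antisym
    (unique-length-≤ _≟_ (unique u) λ {v} v∈ → ∈-filter⁺ (λ v → T? (adjᵇ W v u)) (∈-allFin v) (Adj⇒adjᵇ v∈))
    (unique-length-≤ _≟_ (filter⁺ _ (allFin⁺ n)) λ v∈ →
      adjᵇ⇒Adj (proj₂ (∈-filter⁻ (λ v → T? (adjᵇ W v u)) {xs = allFin n} v∈)))

  -- Each adjacency is counted once from its smaller and once from its larger endpoint.
  adjacency-split : ∀ u v → ind (adjᵇ W v u) ≡ ind ((toℕ u <ᵇ toℕ v) ∧ adjᵇ W u v) + ind ((toℕ v <ᵇ toℕ u) ∧ adjᵇ W v u)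
  adjacency-split u v with <-cmp (toℕ u) (toℕ v)
  ... | tri< u<v _ v≮u rewrite <ᵇ-true u<v | <ᵇ-false v≮u = trans (cong ind (adjᵇ-sym v u)) (sym (+-identityʳ _))
  ... | tri> u≮v _ v<u rewrite <ᵇ-false u≮v | <ᵇ-true v<u = refl
  ... | tri≈ u≮u u≡v _ with refl ← Fin.toℕ-injective u≡v rewrite adjᵇ-irrefl u | <ᵇ-false u≮u = refl

  handshake : 2 * numEdges W ≡ sum (map (deg W) (allFin n))
  handshake = sym (begin
    sum (map (deg W) us)                                      ≡⟨ sum-cong us (λ u → trans (deg-as-count u) (count-as-sum _ us)) ⟩
    sum (map (λ u → sum (map (λ v → ind (adjᵇ W v u)) us)) us) ≡⟨ sum-cong us (λ u → trans (sum-cong us (adjacency-split u)) (sum-+ _ _ us)) ⟩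
    sum (map (λ u → Σ< u + Σ> u) us)                           ≡⟨ sum-+ Σ< Σ> us ⟩
    sum (map Σ< us) + sum (map Σ> us)                          ≡⟨ cong (sum (map Σ< us) +_) (sum-swap (λ u v → ind (below v u)) us us) ⟩
    sum (map Σ< us) + sum (map Σ< us)                          ≡⟨ cong₂ _+_ (sym edges) (trans (sym edges) (sym (+-identityʳ _))) ⟩
    2 * numEdges W                                            ∎)
    where
    open ≡-Reasoning
    us : List (Fin n)
    us = allFin n
    below : Fin n → Fin n → Bool
    below u v = (toℕ u <ᵇ toℕ v) ∧ adjᵇ W u v
    Σ< Σ> : Fin n → ℕ
    Σ< u = sum (map (λ v → ind (below u v)) us)
    Σ> u = sum (map (λ v → ind (below v u)) us)
    edges : numEdges W ≡ sum (map Σ< us)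
    edges = sum-cong us (λ u → count-as-sum (below u) us)

module DegreeClasses {A : Set} (f : A → ℕ) (cls : ∀ x → f x ≡ 1 ⊎ f x ≡ 2 ⊎ f x ≡ 4) where

  count : ℕ → List A → ℕ
  count k xs = length (filter (λ x → f x ≟ℕ k) xs)

  count-∷ : ∀ k x xs → count k (x ∷ xs) ≡ ind ⌊ f x ≟ℕ k ⌋ + count k xs
  count-∷ k x xs with f x ≟ℕ k
  ... | yes fx≡k = cong length (filter-accept (λ x → f x ≟ℕ k) fx≡k)
  ... | no fx≢k = cong length (filter-reject (λ x → f x ≟ℕ k) fx≢k)

  length-by-class : ∀ xs → length xs ≡ count 1 xs + count 2 xs + count 4 xs
  length-by-class [] = refl
  length-by-class (x ∷ xs) with cls x
  ... | inj₁ fx≡1 rewrite count-∷ 1 x xs | count-∷ 2 x xs | count-∷ 4 x xs | fx≡1 | length-by-class xs = refl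
  ... | inj₂ (inj₁ fx≡2) rewrite count-∷ 1 x xs | count-∷ 2 x xs | count-∷ 4 x xs | fx≡2 | length-by-class xs =
    sym (cong (_+ count 4 xs) (+-suc (count 1 xs) (count 2 xs)))
  ... | inj₂ (inj₂ fx≡4) rewrite count-∷ 1 x xs | count-∷ 2 x xs | count-∷ 4 x xs | fx≡4 | length-by-class xs =
    sym (+-suc (count 1 xs + count 2 xs) (count 4 xs))

  sum-by-class : ∀ xs → sum (map f xs) ≡ count 1 xs + 2 * count 2 xs + 4 * count 4 xs
  sum-by-class [] = refl
  sum-by-class (x ∷ xs) with cls x
  ... | inj₁ fx≡1 rewrite count-∷ 1 x xs | count-∷ 2 x xs | count-∷ 4 x xs | fx≡1 | sum-by-class xs = refl
  ... | inj₂ (inj₁ fx≡2) rewrite count-∷ 1 x xs | count-∷ 2 x xs | count-∷ 4 x xs | fx≡2 | sum-by-class xs =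
    shift₂ (count 1 xs) (count 2 xs) (count 4 xs)
    where
    shift₂ : ∀ a b c → 2 + (a + 2 * b + 4 * c) ≡ a + 2 * (1 + b) + 4 * c
    shift₂ = solve-∀
  ... | inj₂ (inj₂ fx≡4) rewrite count-∷ 1 x xs | count-∷ 2 x xs | count-∷ 4 x xs | fx≡4 | sum-by-class xs =
    shift₄ (count 1 xs) (count 2 xs) (count 4 xs)
    where
    shift₄ : ∀ a b c → 4 + (a + 2 * b + 4 * c) ≡ a + 2 * b + 4 * (1 + c)
    shift₄ = solve-∀

euler-arithmetic : ∀ k E F → (3 + k) + F ≡ 2 + E → 2 * E ≡ 4 + 4 * k → 9 + 3 * F ≤ 3 + (4 + 4 * k) → 5 ≤ k
euler-arithmetic k E F euler handshake count = +-cancelˡ-≤ (7 + 3 * k) 5 k (begin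
  7 + 3 * k + 5       ≡⟨ lhs k ⟩
  9 + 3 * (1 + k)     ≡⟨ cong (λ t → 9 + 3 * t) (sym F≡) ⟩
  9 + 3 * F           ≤⟨ count ⟩
  3 + (4 + 4 * k)     ≡⟨ rhs k ⟩
  7 + 3 * k + k       ∎)
  where
  open ≤-Reasoning
  E≡ : E ≡ 2 + 2 * k
  E≡ = *-cancelˡ-≡ E (2 + 2 * k) 2 (trans handshake (double k))
    where
    double : ∀ k → 4 + 4 * k ≡ 2 * (2 + 2 * k)
    double = solve-∀
  F≡ : F ≡ 1 + k
  F≡ = +-cancelˡ-≡ (3 + k) F (1 + k) (trans euler (trans (cong (2 +_) E≡) (split k)))
    where
    split : ∀ k → 2 + (2 + 2 * k) ≡ (3 + k) + (1 + k)
    split = solve-∀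
  lhs : ∀ k → 7 + 3 * k + 5 ≡ 9 + 3 * (1 + k)
  lhs = solve-∀
  rhs : ∀ k → 3 + (4 + 4 * k) ≡ 7 + 3 * k + k
  rhs = solve-∀

-- If a degree-4 vertex had two neighbours of degree < 4 while k ≤ 4, the low/high
-- incidences would exceed 4: (k - 1)(5 - k) + 2 > 4 for 2 ≤ k ≤ 4.
crowded-arithmetic : ∀ k → 2 ≤ k → k ≤ 4 → 3 ≤ (k ∸ 1) * (5 ∸ k)
crowded-arithmetic 1 (s≤s ()) _
crowded-arithmetic 2 _ _ = ≤-refl
crowded-arithmetic 3 _ _ = s≤s (s≤s (s≤s z≤n))
crowded-arithmetic 4 _ _ = ≤-refl
crowded-arithmetic (suc (suc (suc (suc (suc _))))) _ (s≤s (s≤s (s≤s (s≤s ()))))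

module Setting {n : ℕ} (W : RotationSystem n)
  (cls : ∀ v → deg W v ≡ 1 ⊎ deg W v ≡ 2 ⊎ deg W v ≡ 4)
  (count₁ : countDeg W 1 ≡ 2) (count₂ : countDeg W 2 ≡ 1)
  (independent : ∀ u v → deg W u < 4 → deg W v < 4 → ¬ Adj W u v) where

  open RotationSystem W
  open RotationFacts W
  open DegreeClasses (deg W) cls

  k : ℕ
  k = countDeg W 4

  vertex-count : n ≡ 3 + k
  vertex-count = trans (sym (length-tabulate (λ v → v)))
    (trans (length-by-class (allFin n)) (cong₂ (λ a b → a + b + k) count₁ count₂))

  degree-sum : sum (map (deg W) (allFin n)) ≡ 4 + 4 * k
  degree-sum = trans (sum-by-class (allFin n)) (cong₂ (λ a b → a + 2 * b + 4 * k) count₁ count₂)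

  Low : Fin n → Set
  Low v = deg W v < 4

  low? : Decidable Low
  low? v = deg W v <? 4

  not-low⇒4 : ∀ {v} → ¬ Low v → deg W v ≡ 4
  not-low⇒4 {v} not-low with cls v
  ... | inj₁ deg≡1 = contradiction (subst (_< 4) (sym deg≡1) (s≤s (s≤s z≤n))) not-low
  ... | inj₂ (inj₁ deg≡2) = contradiction (subst (_< 4) (sym deg≡2) (s≤s (s≤s (s≤s z≤n)))) not-low
  ... | inj₂ (inj₂ deg≡4) = deg≡4

  4⇒not-low : ∀ {v} → deg W v ≡ 4 → ¬ Low v
  4⇒not-low deg≡4 low = <-irrefl deg≡4 low

  4⇒2≤ : ∀ {v} → deg W v ≡ 4 → 2 ≤ deg W v
  4⇒2≤ deg≡4 = subst (2 ≤_) (sym deg≡4) (s≤s (s≤s z≤n))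

  low-neighbour-4 : ∀ {l u} → Low l → u ∈ rot l → deg W u ≡ 4
  low-neighbour-4 {l} {u} l-low u∈ = not-low⇒4 (λ u-low → independent u l u-low l-low u∈)

  lows highs : List (Fin n)
  lows = filter low? (allFin n)
  highs = filter (∁? low?) (allFin n)

  length-highs : length highs ≡ k
  length-highs = cong length (filter-≐ (∁? low?) (λ v → deg W v ≟ℕ 4) (not-low⇒4 , λ deg≡4 → 4⇒not-low deg≡4) (allFin n))

  length-lows : length lows ≡ 3
  length-lows = +-cancelʳ-≡ k (length lows) 3 (begin
    length lows + k             ≡⟨ cong (length lows +_) (sym length-highs) ⟩
    length lows + length highs  ≡⟨ length-filter-∁ low? (allFin n) ⟩
    length (allFin n)           ≡⟨ length-tabulate (λ v → v) ⟩
    n                           ≡⟨ vertex-count ⟩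
    3 + k                       ∎)
    where open ≡-Reasoning

  low-degree-sum : sum (map (deg W) lows) ≡ 4
  low-degree-sum = +-cancelʳ-≡ (4 * k) _ 4 (begin
    sum (map (deg W) lows) + 4 * k                       ≡⟨ cong (sum (map (deg W) lows) +_) (sym high-sum) ⟩
    sum (map (deg W) lows) + sum (map (deg W) highs)     ≡⟨ sum-filter-∁ low? (deg W) (allFin n) ⟩
    sum (map (deg W) (allFin n))                         ≡⟨ degree-sum ⟩
    4 + 4 * k                                            ∎)
    where
    open ≡-Reasoning
    high-sum : sum (map (deg W) highs) ≡ 4 * k
    high-sum = trans (sum-const (deg W) 4 highs (λ v∈ → not-low⇒4 (proj₂ (∈-filter⁻ (∁? low?) {xs = allFin n} v∈))))
                     (cong (4 *_) length-highs)

  lowNeighbours : Fin n → List (Fin n)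
  lowNeighbours h = filter low? (rot h)

  lowNeighbours≤3 : ∀ h → length (lowNeighbours h) ≤ 3
  lowNeighbours≤3 h = subst (length (lowNeighbours h) ≤_) length-lows
    (unique-length-≤ _≟_ (filter⁺ low? (unique h))
      λ {l} l∈ → ∈-filter⁺ low? (∈-allFin l) (proj₂ (∈-filter⁻ low? {xs = rot h} l∈)))

  -- A degree-4 vertex h has 4 - |lowNeighbours h| neighbours of degree 4, which together
  -- with h itself are distinct vertices of degree 4.
  high-vertex-bound : ∀ {h} → deg W h ≡ 4 → 5 ≤ length (lowNeighbours h) + k
  high-vertex-bound {h} deg≡4 = begin
    5                    ≡⟨ cong suc (sym (trans (length-filter-∁ low? (rot h)) deg≡4)) ⟩
    suc (L + length H)   ≡⟨ sym (+-suc L (length H)) ⟩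
    L + length (h ∷ H)   ≤⟨ +-monoʳ-≤ L (subst (length (h ∷ H) ≤_) length-highs (unique-length-≤ _≟_ h∷H-unique h∷H⊆highs)) ⟩
    L + k                ∎
    where
    open ≤-Reasoning
    L : ℕ
    L = length (lowNeighbours h)
    H : List (Fin n)
    H = filter (∁? low?) (rot h)
    h∷H-unique : Unique (h ∷ H)
    h∷H-unique = All.tabulate (λ u∈H h≡u → loopless h (subst (_∈ rot h) (sym h≡u) (proj₁ (∈-filter⁻ (∁? low?) {xs = rot h} u∈H))))
                 ∷ filter⁺ (∁? low?) (unique h)
    h∷H⊆highs : ∀ {u} → u ∈ h ∷ H → u ∈ highs
    h∷H⊆highs (here refl) = ∈-filter⁺ (∁? low?) (∈-allFin h) (4⇒not-low deg≡4)
    h∷H⊆highs {u} (there u∈H) = ∈-filter⁺ (∁? low?) (∈-allFin u) (proj₂ (∈-filter⁻ (∁? low?) {xs = rot h} u∈H))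

  -- Counting the darts l → h from low to high vertices in two ways: there are at most
  -- Σ_{low l} deg l = 4 of them.
  incidences≤4 : sum (map (length ∘ lowNeighbours) highs) ≤ 4
  incidences≤4 = begin
    sum (map (length ∘ lowNeighbours) highs)  ≡⟨ sum-cong highs (λ h → sym (length-map (_, h) (lowNeighbours h))) ⟩
    sum (map (length ∘ incoming) highs)       ≡⟨ sym (length-concatMap incoming highs) ⟩
    length (concatMap incoming highs)         ≤⟨ unique-length-≤ _≟ᵈ_ incoming-unique incoming⊆ ⟩
    length (concatMap outgoing lows)          ≡⟨ length-concatMap outgoing lows ⟩
    sum (map (length ∘ outgoing) lows)        ≡⟨ sum-cong lows (λ l → length-map (l ,_) (rot l)) ⟩
    sum (map (deg W) lows)                    ≡⟨ low-degree-sum ⟩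
    4                                         ∎
    where
    open ≤-Reasoning
    incoming : Fin n → List (Dart W)
    incoming h = map (_, h) (lowNeighbours h)
    outgoing : Fin n → List (Dart W)
    outgoing l = map (l ,_) (rot l)
    head≡ : ∀ {h d} → d ∈ incoming h → proj₂ d ≡ h
    head≡ d∈ with _ , _ , refl ← ∈-map⁻ _ d∈ = refl
    incoming-unique : Unique (concatMap incoming highs)
    incoming-unique = concatMap-unique incoming highs (filter⁺ (∁? low?) (allFin⁺ n))
      (λ {h} _ → map⁺ (cong proj₁) (filter⁺ low? (unique h)))
      λ _ _ d∈ d∈' → trans (sym (head≡ d∈)) (head≡ d∈')
    incoming⊆ : ∀ {d} → d ∈ concatMap incoming highs → d ∈ concatMap outgoing lows
    incoming⊆ d∈ with h , _ , d∈h ← ∈-concatMap-∃ incoming {xs = highs} d∈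
      with l , l∈ , refl ← ∈-map⁻ (_, h) d∈h
      with l∈rot-h , l-low ← ∈-filter⁻ low? {xs = rot h} l∈ =
      ∈-concatMap⁺ outgoing (lose (∈-filter⁺ low? (∈-allFin l) l-low) (∈-map⁺ (l ,_) (symm l h l∈rot-h)))

  -- If at most four vertices have degree 4, no vertex of degree 4 has two low neighbours:
  -- otherwise the incidences would number at least (k - 1)(5 - k) + 2 > 4.
  one-low-neighbour : k ≤ 4 → ∀ {h l l'} → deg W h ≡ 4 → l ∈ rot h → l' ∈ rot h → Low l → Low l' → l ≡ l'
  one-low-neighbour k≤4 {h} {l} {l'} deg≡4 l∈ l'∈ l-low l'-low with l ≟ l'
  ... | yes l≡l' = l≡l'
  ... | no l≢l' = contradiction too-many (<-irrefl refl)
    where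
    open ≤-Reasoning
    L : ℕ
    L = length (lowNeighbours h)
    2≤L : 2 ≤ L
    2≤L = unique-length-≤ _≟_ {xs = l ∷ l' ∷ []} ((l≢l' ∷ []) ∷ [] ∷ [])
      λ { (here refl) → ∈-filter⁺ low? l∈ l-low ; (there (here refl)) → ∈-filter⁺ low? l'∈ l'-low }
    2≤k : 2 ≤ k
    2≤k = +-cancelˡ-≤ 3 2 k (≤-trans (high-vertex-bound deg≡4) (+-monoˡ-≤ k (lowNeighbours≤3 h)))
    each-high : ∀ {h'} → h' ∈ highs → 5 ∸ k ≤ length (lowNeighbours h')
    each-high {h'} h'∈ = subst (5 ∸ k ≤_) (m+n∸n≡m _ k)
      (∸-monoˡ-≤ k (high-vertex-bound (not-low⇒4 (proj₂ (∈-filter⁻ (∁? low?) {xs = allFin n} h'∈)))))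
    too-many : 5 ≤ 4
    too-many = begin
      3 + 2                                     ≤⟨ +-mono-≤ (crowded-arithmetic k 2≤k k≤4) 2≤L ⟩
      (k ∸ 1) * (5 ∸ k) + L                     ≡⟨ cong (λ t → (t ∸ 1) * (5 ∸ k) + L) (sym length-highs) ⟩
      (length highs ∸ 1) * (5 ∸ k) + L          ≤⟨ sum-≥ (length ∘ lowNeighbours) (5 ∸ k) highs each-high
                                                      (∈-filter⁺ (∁? low?) (∈-allFin h) (4⇒not-low deg≡4)) ⟩
      sum (map (length ∘ lowNeighbours) highs)  ≤⟨ incidences≤4 ⟩
      4                                         ∎

  -- Every edge has an endpoint of degree 4, so there are no digons.
  no-digons : NoDigons
  no-digons = noDigons big-end
    where
    big-end : ∀ u v → Adj W u v → 2 ≤ deg W u ⊎ 2 ≤ deg W v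
    big-end u v u∈ with low? u
    ... | yes u-low = inj₂ (4⇒2≤ (low-neighbour-4 u-low (symm u v u∈)))
    ... | no u-high = inj₁ (4⇒2≤ (not-low⇒4 u-high))

  -- The face of o passes through every low vertex; when k ≤ 4 these passages give
  -- 3 · 3 = 9 distinct darts on the face of o.
  module OuterFace (k≤4 : k ≤ 4) {o : Dart W} (o-dart : IsDart W o) (on-outer : ∀ v → Low v → OnFace W o v) where

    around : Fin n → List (Dart W)
    around l with low? l
    ... | yes l-low = Passage.darts (passage o-dart (on-outer l l-low))
    ... | no _ = []

    around-length : ∀ {l} → Low l → length (around l) ≡ 3
    around-length {l} l-low with low? l
    ... | yes _ = refl
    ... | no not-low = contradiction l-low not-low

    around-unique : ∀ l → Unique (around l)
    around-unique l with low? l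
    ... | yes l-low = Passage.darts-unique P (4⇒2≤ (low-neighbour-4 l-low (Passage.w-adj P)))
      where P = passage o-dart (on-outer l l-low)
    ... | no _ = []

    around-on-outer : ∀ {l x} → x ∈ around l → o ↝ x
    around-on-outer {l} x∈ with low? l
    ... | yes l-low = Passage.darts-on-face (passage o-dart (on-outer l l-low)) x∈

    around-tail : ∀ {l x} → x ∈ around l → Low l × (proj₁ x ≡ l ⊎ proj₁ x ∈ rot l)
    around-tail {l} x∈ with low? l
    ... | yes l-low = l-low , Passage.darts-tail (passage o-dart (on-outer l l-low)) x∈

    -- Passages through distinct low vertices are disjoint: a common dart would start at
    -- a low vertex adjacent to another, or at a degree-4 vertex with two low neighbours.
    around-disjoint : ∀ {l l' x} → x ∈ around l → x ∈ around l' → l ≡ l'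
    around-disjoint x∈ x∈' with around-tail x∈ | around-tail x∈'
    ... | _ , inj₁ refl | _ , inj₁ refl = refl
    ... | l-low , inj₁ refl | l'-low , inj₂ t∈l' = contradiction t∈l' (independent _ _ l-low l'-low)
    ... | l-low , inj₂ t∈l | l'-low , inj₁ refl = contradiction t∈l (independent _ _ l'-low l-low)
    ... | l-low , inj₂ t∈l | l'-low , inj₂ t∈l' =
      one-low-neighbour k≤4 (low-neighbour-4 l-low t∈l) (symm _ _ t∈l) (symm _ _ t∈l') l-low l'-low

    outer-darts : List (Dart W)
    outer-darts = concatMap around lows

    length-outer-darts : length outer-darts ≡ 9
    length-outer-darts = trans (length-concatMap around lows)
      (trans (sum-const (length ∘ around) 3 lows (λ l∈ → around-length (proj₂ (∈-filter⁻ low? {xs = allFin n} l∈))))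
             (cong (3 *_) length-lows))

    outer-darts-unique : Unique outer-darts
    outer-darts-unique = concatMap-unique around lows (filter⁺ low? (allFin⁺ n)) (λ {l} _ → around-unique l)
      λ _ _ → around-disjoint

    outer-darts-on-outer : ∀ {x} → x ∈ outer-darts → o ↝ x
    outer-darts-on-outer x∈ with _ , _ , x∈l ← ∈-concatMap-∃ around {xs = lows} x∈ = around-on-outer x∈l

    face-bound : 9 + 3 * numFaces W ≤ 3 + (4 + 4 * k)
    face-bound = subst₂ (λ s t → s + 3 * numFaces W ≤ 3 + t) length-outer-darts degree-sum
      (face-count no-digons o-dart outer-darts outer-darts-unique outer-darts-on-outer)

  not-at-most-four : Planar W → ∀ {o} → IsDart W o → (∀ v → Low v → OnFace W o v) → ¬ k ≤ 4
  not-at-most-four planar o-dart on-outer k≤4 = contradiction (≤-trans at-least-five k≤4) (<-irrefl refl)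
    where
    at-least-five : 5 ≤ k
    at-least-five = euler-arithmetic k (numEdges W) (numFaces W)
      (subst (λ m → m + numFaces W ≡ 2 + numEdges W) vertex-count planar)
      (trans handshake degree-sum)
      (OuterFace.face-bound k≤4 o-dart on-outer)

lemma3 : (n : ℕ) (W : RotationSystem n) →
    Connected W →
    Planar W →
    (∀ v → deg W v ≡ 1 ⊎ deg W v ≡ 2 ⊎ deg W v ≡ 4) →
    countDeg W 1 ≡ 2 →
    countDeg W 2 ≡ 1 →
    (∀ u v → deg W u < 4 → deg W v < 4 → ¬ Adj W u v) →
    Σ (Dart W) (λ outer → IsDart W outer × (∀ v → deg W v < 4 → OnFace W outer v)) →
    5 ≤ countDeg W 4
lemma3 n W _ planar cls count₁ count₂ independent (o , o-dart , on-outer) =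
  ≰⇒> (Setting.not-at-most-four W cls count₁ count₂ independent planar o-dart on-outer)
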